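{- For every non-negative integer $n$ and every integer $s$, \[ \sum_{k = 0}^{\lfloor n/2 \rfloor} \binom {n}{2k} 9^{k} F_{6k + s} = 2^{n-1} \begin{cases} F_{4n + s} + 5^{n/2} F_{2n+s}, & \text{$n$ even;}\\ F_{4n + s} - 5^{(n-1)/2}L_{2n+s}, & \text{$n$ odd,} \end{cases} \] \[ \sum_{k = 0}^{\lfloor n/2 \rfloor} \binom {n}{2k} 9^{k} L_{6k + s} = 2^{n-1} \begin{cases} L_{4n + s} + 5^{n/2}L_{2n+s}, & \text{$n$ even;}\\ L_{4n + s} - 5^{(n+1)/2}F_{2n+s}, & \text{$n$ odd.} \end{cases} \]
   Context: The Fibonacci numbers $F_j$ and Lucas numbers $L_j$ are defined for all integers $j$ by $F_0=0$, $F_1=1$, $L_0=2$, $L_1=1$, $F_j=F_{j-1}+F_{j-2}$, $L_j=L_{j-1}+L_{j-2}$, with $F_{ -j}=(-1)^{j-1}F_j$ and $L_{ -j}=(-1)^jL_j$. -}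

module Defs where

open import Data.Nat as ℕ using (ℕ; zero; suc)
open import Data.Integer as ℤ using (ℤ; +_; -[1+_]; _+_; _*_; -_)

fibℕ : ℕ → ℤ
fibℕ 0 = + 0
fibℕ 1 = + 1
fibℕ (suc (suc n)) = fibℕ (suc n) + fibℕ n

lucℕ : ℕ → ℤ
lucℕ 0 = + 2
lucℕ 1 = + 1
lucℕ (suc (suc n)) = lucℕ (suc n) + lucℕ n

sgn : ℕ → ℤ
sgn zero = + 1
sgn (suc j) = - sgn j

-- Extension to all integers: F_{-j} = (-1)^{j-1} F_j, L_{-j} = (-1)^j L_j
F : ℤ → ℤ
F (+ n) = fibℕ n
F -[1+ n ] = sgn n * fibℕ (suc n)

L : ℤ → ℤ
L (+ n) = lucℕ n
L -[1+ n ] = sgn (suc n) * lucℕ (suc n)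

sumTo : ℕ → (ℕ → ℤ) → ℤ
sumTo zero f = f 0
sumTo (suc m) f = sumTo m f + f (suc m)

-- Write E for the shift (E G) s = G (1 + s). On Fibonacci-type sequences
-- 1 + 3E³ acts as 2E⁴, while 1 − 3E³ maps F to −2E²L and L to −10E²F, so
-- (1 − 3E³)² acts as 20E⁴. Expanding (1 ± 3E³)ⁿ binomially, the even-index
-- terms of the two expansions agree and the odd-index ones cancel, hence
-- 2 Σₖ C(n,2k) 9ᵏ E⁶ᵏ = (1 + 3E³)ⁿ + (1 − 3E³)ⁿ, which evaluates to both identities.
-- Each operator identity needs checking only at two consecutive points, because a
-- sequence satisfying the Fibonacci recurrence on all of ℤ is determined by them.
module Submission where

open import Defs
open import Data.Nat as ℕ using (ℕ; _/_)
open import Data.Nat.Combinatorics using (_C_)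
open import Data.Integer as ℤ using (ℤ; +_; _+_; _-_; _*_; _^_)
open import Data.Product using (_×_)
open import Relation.Binary.PropositionalEquality using (_≡_)

open import Data.Nat using (zero; suc)
import Data.Nat.Properties as ℕP
open import Data.Nat.DivMod using (m/n≤m; /-monoˡ-≤; m*n/n≡m)
open import Data.Nat.Combinatorics using (nCk+nC[k+1]≡[n+1]C[k+1]; k>n⇒nCk≡0)
import Data.Nat.Tactic.RingSolver as ℕSolver
open import Data.Integer using (-[1+_]; -_)
open import Data.Integer.Properties
  using (+-assoc; +-identityˡ; +-identityʳ; *-identityˡ; *-assoc; *-distribˡ-+; *-distribʳ-+;
         neg-distrib-+; i≡j⇒i-j≡0; i-j≡0⇒i≡j; ^-*-assoc; ^-distribˡ-+-*; +-commutativeSemigroup)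
open import Algebra.Properties.CommutativeSemigroup +-commutativeSemigroup
  using (x∙yz≈y∙xz; interchange)
open import Data.Integer.Tactic.RingSolver using (solve-∀)
open import Data.Product using (_,_)
open import Relation.Binary.PropositionalEquality
  using (refl; sym; trans; cong; cong₂; subst; module ≡-Reasoning)

open ≡-Reasoning

shift-assoc : ∀ a b s → + (a ℕ.+ b) + s ≡ + a + (+ b + s)
shift-assoc a b = +-assoc (+ a) (+ b)

record Recurrent (G : ℤ → ℤ) : Set where
  field recurrence : ∀ s → G (+ 2 + s) ≡ G (+ 1 + s) + G s
open Recurrent

F-recurrent : Recurrent F
F-recurrent .recurrence (+ n)              = refl
F-recurrent .recurrence -[1+ 0 ]           = refl
F-recurrent .recurrence -[1+ 1 ]           = refl
F-recurrent .recurrence -[1+ suc (suc n) ] = sign-flip (sgn n) (fibℕ (suc n)) (fibℕ n)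
  where
  sign-flip : ∀ σ a b → σ * a ≡ (- σ) * (a + b) + (- (- σ)) * ((a + b) + a)
  sign-flip = solve-∀

L-recurrent : Recurrent L
L-recurrent .recurrence (+ n)              = refl
L-recurrent .recurrence -[1+ 0 ]           = refl
L-recurrent .recurrence -[1+ 1 ]           = refl
L-recurrent .recurrence -[1+ suc (suc n) ] = sign-flip (sgn n) (lucℕ (suc n)) (lucℕ n)
  where
  sign-flip : ∀ σ a b → (- σ) * a ≡ (- (- σ)) * (a + b) + (- (- (- σ))) * ((a + b) + a)
  sign-flip = solve-∀

Recurrent-shift : ∀ i {G} → Recurrent G → Recurrent (λ s → G (+ i + s))
Recurrent-shift i {G} rG .recurrence s = begin
  G (+ i + (+ 2 + s))                ≡⟨ cong G (x∙yz≈y∙xz (+ i) (+ 2) s) ⟩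
  G (+ 2 + (+ i + s))                ≡⟨ rG .recurrence (+ i + s) ⟩
  G (+ 1 + (+ i + s)) + G (+ i + s)  ≡⟨ cong (λ t → G t + G (+ i + s)) (x∙yz≈y∙xz (+ 1) (+ i) s) ⟩
  G (+ i + (+ 1 + s)) + G (+ i + s)  ∎

Recurrent-scale : ∀ a {G} → Recurrent G → Recurrent (λ s → a * G s)
Recurrent-scale a rG .recurrence s = trans (cong (a *_) (rG .recurrence s)) (*-distribˡ-+ a _ _)

Recurrent-neg : ∀ {G} → Recurrent G → Recurrent (λ s → - G s)
Recurrent-neg {G} rG .recurrence s =
  trans (cong -_ (rG .recurrence s)) (neg-distrib-+ (G (+ 1 + s)) (G s))

Recurrent-add : ∀ {G H} → Recurrent G → Recurrent H → Recurrent (λ s → G s + H s)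
Recurrent-add {G} {H} rG rH .recurrence s =
  trans (cong₂ _+_ (rG .recurrence s) (rH .recurrence s))
        (interchange (G (+ 1 + s)) (G s) (H (+ 1 + s)) (H s))

Recurrent-zero : ∀ {Z} → Recurrent Z → Z (+ 0) ≡ + 0 → Z (+ 1) ≡ + 0 → ∀ s → Z s ≡ + 0
Recurrent-zero {Z} rZ z₀ z₁ = λ where
    (+ n)    → forward n
    -[1+ n ] → backward n
  where
  cancel : ∀ {a b c} → a ≡ b + c → a ≡ + 0 → b ≡ + 0 → c ≡ + 0
  cancel {a} {b} {c} a≡b+c a≡0 b≡0 = begin
    c        ≡⟨ sym (+-identityˡ c) ⟩
    + 0 + c  ≡⟨ cong (_+ c) (sym b≡0) ⟩
    b + c    ≡⟨ sym a≡b+c ⟩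
    a        ≡⟨ a≡0 ⟩
    + 0      ∎

  forward : ∀ n → Z (+ n) ≡ + 0
  forward 0             = z₀
  forward 1             = z₁
  forward (suc (suc n)) = trans (rZ .recurrence (+ n)) (cong₂ _+_ (forward (suc n)) (forward n))

  backward : ∀ n → Z -[1+ n ] ≡ + 0
  backward 0             = cancel (rZ .recurrence -[1+ 0 ]) z₁ z₀
  backward 1             = cancel (rZ .recurrence -[1+ 1 ]) z₀ (backward 0)
  backward (suc (suc n)) = cancel (rZ .recurrence -[1+ suc (suc n) ]) (backward n) (backward (suc n))

Recurrent-unique : ∀ {G H} → Recurrent G → Recurrent H →
                   G (+ 0) ≡ H (+ 0) → G (+ 1) ≡ H (+ 1) → ∀ s → G s ≡ H s
Recurrent-unique {G} {H} rG rH e₀ e₁ s = i-j≡0⇒i≡j (G s) (H s)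
  (Recurrent-zero (Recurrent-add rG (Recurrent-neg rH)) (i≡j⇒i-j≡0 e₀) (i≡j⇒i-j≡0 e₁) s)

-- shiftStep c d = 1 + c·Eᵈ and shiftPower c d n = (1 + c·Eᵈ)ⁿ.
shiftStep : ℤ → ℕ → (ℤ → ℤ) → ℤ → ℤ
shiftStep c d G s = G s + c * G (+ d + s)

shiftPower : ℤ → ℕ → ℕ → (ℤ → ℤ) → ℤ → ℤ
shiftPower c d zero    G = G
shiftPower c d (suc n) G = shiftStep c d (shiftPower c d n G)

Recurrent-shiftStep : ∀ c d {G} → Recurrent G → Recurrent (shiftStep c d G)
Recurrent-shiftStep c d rG = Recurrent-add rG (Recurrent-scale c (Recurrent-shift d rG))

F-[1+3E³]≡2E⁴ : ∀ s → shiftStep (+ 3) 3 F s ≡ + 2 * F (+ 4 + s)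
F-[1+3E³]≡2E⁴ = Recurrent-unique (Recurrent-shiftStep (+ 3) 3 F-recurrent)
  (Recurrent-scale (+ 2) (Recurrent-shift 4 F-recurrent)) refl refl

L-[1+3E³]≡2E⁴ : ∀ s → shiftStep (+ 3) 3 L s ≡ + 2 * L (+ 4 + s)
L-[1+3E³]≡2E⁴ = Recurrent-unique (Recurrent-shiftStep (+ 3) 3 L-recurrent)
  (Recurrent-scale (+ 2) (Recurrent-shift 4 L-recurrent)) refl refl

F-[1-3E³]≡-2E²L : ∀ s → shiftStep (- + 3) 3 F s ≡ - + 2 * L (+ 2 + s)
F-[1-3E³]≡-2E²L = Recurrent-unique (Recurrent-shiftStep (- + 3) 3 F-recurrent)
  (Recurrent-scale (- + 2) (Recurrent-shift 2 L-recurrent)) refl refl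

L-[1-3E³]≡-10E²F : ∀ s → shiftStep (- + 3) 3 L s ≡ - + 10 * F (+ 2 + s)
L-[1-3E³]≡-10E²F = Recurrent-unique (Recurrent-shiftStep (- + 3) 3 L-recurrent)
  (Recurrent-scale (- + 10) (Recurrent-shift 2 F-recurrent)) refl refl

F-[1-3E³]²≡20E⁴ : ∀ s → shiftStep (- + 3) 3 (shiftStep (- + 3) 3 F) s ≡ + 20 * F (+ 4 + s)
F-[1-3E³]²≡20E⁴ = Recurrent-unique
  (Recurrent-shiftStep (- + 3) 3 (Recurrent-shiftStep (- + 3) 3 F-recurrent))
  (Recurrent-scale (+ 20) (Recurrent-shift 4 F-recurrent)) refl refl

L-[1-3E³]²≡20E⁴ : ∀ s → shiftStep (- + 3) 3 (shiftStep (- + 3) 3 L) s ≡ + 20 * L (+ 4 + s)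
L-[1-3E³]²≡20E⁴ = Recurrent-unique
  (Recurrent-shiftStep (- + 3) 3 (Recurrent-shiftStep (- + 3) 3 L-recurrent))
  (Recurrent-scale (+ 20) (Recurrent-shift 4 L-recurrent)) refl refl

shiftStep-homogeneous : ∀ c d {G H} b i → (∀ t → H t ≡ b * G (+ i + t)) →
                        ∀ t → shiftStep c d H t ≡ b * shiftStep c d G (+ i + t)
shiftStep-homogeneous c d {G} {H} b i H≡bEⁱG t = begin
  H t + c * H (+ d + t)
    ≡⟨ cong₂ (λ x y → x + c * y) (H≡bEⁱG t) (H≡bEⁱG (+ d + t)) ⟩
  b * G (+ i + t) + c * (b * G (+ i + (+ d + t)))
    ≡⟨ cong (λ u → b * G (+ i + t) + c * (b * G u)) (x∙yz≈y∙xz (+ i) (+ d) t) ⟩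
  b * G (+ i + t) + c * (b * G (+ d + (+ i + t)))
    ≡⟨ factor b c (G (+ i + t)) (G (+ d + (+ i + t))) ⟩
  b * (G (+ i + t) + c * G (+ d + (+ i + t)))
    ∎
  where
  factor : ∀ b c x y → b * x + c * (b * y) ≡ b * (x + c * y)
  factor = solve-∀

scaledShift-zero : ∀ a e (G : ℤ → ℤ) s → G s ≡ a ^ 0 * G (+ (e ℕ.* 0) + s)
scaledShift-zero a e G s = begin
  G s                       ≡⟨ sym (*-identityˡ (G s)) ⟩
  + 1 * G s                 ≡⟨ cong (λ t → + 1 * G t) (sym (+-identityˡ s)) ⟩
  + 1 * G (+ 0 + s)         ≡⟨ cong (λ k → + 1 * G (+ k + s)) (sym (ℕP.*-zeroʳ e)) ⟩
  + 1 * G (+ (e ℕ.* 0) + s) ∎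

scaledShift-suc : ∀ a e (G : ℤ → ℤ) n s →
                  a ^ n * (a * G (+ e + (+ (e ℕ.* n) + s))) ≡ a ^ suc n * G (+ (e ℕ.* suc n) + s)
scaledShift-suc a e G n s = begin
  a ^ n * (a * G (+ e + (+ (e ℕ.* n) + s)))
    ≡⟨ rearrange a (a ^ n) (G (+ e + (+ (e ℕ.* n) + s))) ⟩
  a * a ^ n * G (+ e + (+ (e ℕ.* n) + s))
    ≡⟨ cong (λ t → a * a ^ n * G t) (sym (shift-assoc e (e ℕ.* n) s)) ⟩
  a * a ^ n * G (+ (e ℕ.+ e ℕ.* n) + s)
    ≡⟨ cong (λ k → a * a ^ n * G (+ k + s)) (sym (ℕP.*-suc e n)) ⟩
  a * a ^ n * G (+ (e ℕ.* suc n) + s)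
    ∎
  where
  rearrange : ∀ a x g → x * (a * g) ≡ a * x * g
  rearrange = solve-∀

shiftPower-eigen : ∀ c d a e {G} → (∀ t → shiftStep c d G t ≡ a * G (+ e + t)) →
                   ∀ n s → shiftPower c d n G s ≡ a ^ n * G (+ (e ℕ.* n) + s)
shiftPower-eigen c d a e {G} step≡aEᵉ zero    s = scaledShift-zero a e G s
shiftPower-eigen c d a e {G} step≡aEᵉ (suc n) s = begin
  shiftStep c d (shiftPower c d n G) s
    ≡⟨ shiftStep-homogeneous c d {G} (a ^ n) (e ℕ.* n) (shiftPower-eigen c d a e step≡aEᵉ n) s ⟩
  a ^ n * shiftStep c d G (+ (e ℕ.* n) + s)
    ≡⟨ cong (a ^ n *_) (step≡aEᵉ (+ (e ℕ.* n) + s)) ⟩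
  a ^ n * (a * G (+ e + (+ (e ℕ.* n) + s)))
    ≡⟨ scaledShift-suc a e G n s ⟩
  a ^ suc n * G (+ (e ℕ.* suc n) + s)
    ∎

shiftPower-even : ∀ c d a e {G} → (∀ t → shiftStep c d (shiftStep c d G) t ≡ a * G (+ e + t)) →
                  ∀ m s → shiftPower c d (2 ℕ.* m) G s ≡ a ^ m * G (+ (e ℕ.* m) + s)
shiftPower-even c d a e {G} step²≡aEᵉ zero    s = scaledShift-zero a e G s
shiftPower-even c d a e {G} step²≡aEᵉ (suc m) s = begin
  shiftPower c d (2 ℕ.* suc m) G s
    ≡⟨ cong (λ k → shiftPower c d k G s) (ℕP.*-suc 2 m) ⟩
  shiftStep c d (shiftStep c d (shiftPower c d (2 ℕ.* m) G)) s
    ≡⟨ shiftStep-homogeneous c d {shiftStep c d G} (a ^ m) (e ℕ.* m)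
         (shiftStep-homogeneous c d {G} (a ^ m) (e ℕ.* m) (shiftPower-even c d a e step²≡aEᵉ m)) s ⟩
  a ^ m * shiftStep c d (shiftStep c d G) (+ (e ℕ.* m) + s)
    ≡⟨ cong (a ^ m *_) (step²≡aEᵉ (+ (e ℕ.* m) + s)) ⟩
  a ^ m * (a * G (+ e + (+ (e ℕ.* m) + s)))
    ≡⟨ scaledShift-suc a e G m s ⟩
  a ^ suc m * G (+ (e ℕ.* suc m) + s)
    ∎

shiftPower-odd : ∀ c d a e {G} → (∀ t → shiftStep c d (shiftStep c d G) t ≡ a * G (+ e + t)) →
                 ∀ m s → shiftPower c d (suc (2 ℕ.* m)) G s ≡ a ^ m * shiftStep c d G (+ (e ℕ.* m) + s)
shiftPower-odd c d a e {G} step²≡aEᵉ m =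
  shiftStep-homogeneous c d {G} (a ^ m) (e ℕ.* m) (shiftPower-even c d a e step²≡aEᵉ m)

sumTo-cong : ∀ m {f g} → (∀ k → f k ≡ g k) → sumTo m f ≡ sumTo m g
sumTo-cong zero    f≡g = f≡g 0
sumTo-cong (suc m) f≡g = cong₂ _+_ (sumTo-cong m f≡g) (f≡g (suc m))

sumTo-+ : ∀ m f g → sumTo m (λ k → f k + g k) ≡ sumTo m f + sumTo m g
sumTo-+ zero    f g = refl
sumTo-+ (suc m) f g = trans (cong (_+ (f (suc m) + g (suc m))) (sumTo-+ m f g))
  (interchange (sumTo m f) (sumTo m g) (f (suc m)) (g (suc m)))

sumTo-*ˡ : ∀ m a f → sumTo m (λ k → a * f k) ≡ a * sumTo m f
sumTo-*ˡ zero    a f = refl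
sumTo-*ˡ (suc m) a f = trans (cong (_+ a * f (suc m)) (sumTo-*ˡ m a f))
  (sym (*-distribˡ-+ a (sumTo m f) (f (suc m))))

sumTo-suc : ∀ m f → sumTo (suc m) f ≡ f 0 + sumTo m (λ k → f (suc k))
sumTo-suc zero    f = refl
sumTo-suc (suc m) f = trans (cong (_+ f (suc (suc m))) (sumTo-suc m f))
  (+-assoc (f 0) (sumTo m (λ k → f (suc k))) (f (suc (suc m))))

sumTo-vanishing-tail : ∀ {m N} f → m ℕ.≤ N → (∀ k → m ℕ.< k → f k ≡ + 0) →
                       sumTo N f ≡ sumTo m f
sumTo-vanishing-tail {m} f m≤N vanish = go (ℕP.≤⇒≤′ m≤N)
  where
  go : ∀ {N} → m ℕ.≤′ N → sumTo N f ≡ sumTo m f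
  go ℕ.≤′-refl            = refl
  go (ℕ.≤′-step {n} m≤′n) =
    trans (cong₂ _+_ (go m≤′n) (vanish (suc n) (ℕ.s≤s (ℕP.≤′⇒≤ m≤′n)))) (+-identityʳ (sumTo m f))

evenSum oddSum : ℕ → (ℕ → ℤ) → ℤ
evenSum n w = sumTo n (λ k → + (n C (2 ℕ.* k)) * w k)
oddSum  n w = sumTo n (λ k → + (n C suc (2 ℕ.* k)) * w k)

C-vanishing : ∀ {n j} → n ℕ.< j → ∀ x → + (n C j) * x ≡ + 0
C-vanishing n<j x rewrite k>n⇒nCk≡0 n<j = refl

C-pascal : ∀ n j x → + (suc n C suc j) * x ≡ + (n C j) * x + + (n C suc j) * x
C-pascal n j x = begin
  + (suc n C suc j) * x               ≡⟨ cong (λ c → + c * x) (sym (nCk+nC[k+1]≡[n+1]C[k+1] n j)) ⟩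
  (+ (n C j) + + (n C suc j)) * x     ≡⟨ *-distribʳ-+ x (+ (n C j)) (+ (n C suc j)) ⟩
  + (n C j) * x + + (n C suc j) * x   ∎

evenSum-extend : ∀ n w → sumTo (suc n) (λ k → + (n C (2 ℕ.* k)) * w k) ≡ evenSum n w
evenSum-extend n w = sumTo-vanishing-tail _ (ℕP.n≤1+n n)
  (λ k n<k → C-vanishing (ℕP.<-≤-trans n<k (ℕP.m≤m+n k (k ℕ.+ 0))) (w k))

oddSum-extend : ∀ n w → sumTo (suc n) (λ k → + (n C suc (2 ℕ.* k)) * w k) ≡ oddSum n w
oddSum-extend n w = sumTo-vanishing-tail _ (ℕP.n≤1+n n)
  (λ k n<k → C-vanishing (ℕP.m<n⇒m<1+n (ℕP.<-≤-trans n<k (ℕP.m≤m+n k (k ℕ.+ 0)))) (w k))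

oddSum-suc : ∀ n w → oddSum (suc n) w ≡ evenSum n w + oddSum n w
oddSum-suc n w = begin
  oddSum (suc n) w                        ≡⟨ sumTo-cong (suc n) (λ k → C-pascal n (2 ℕ.* k) (w k)) ⟩
  sumTo (suc n) (λ k → even k + odd k)    ≡⟨ sumTo-+ (suc n) even odd ⟩
  sumTo (suc n) even + sumTo (suc n) odd  ≡⟨ cong₂ _+_ (evenSum-extend n w) (oddSum-extend n w) ⟩
  evenSum n w + oddSum n w                ∎
  where
  even odd : ℕ → ℤ
  even k = + (n C (2 ℕ.* k)) * w k
  odd  k = + (n C suc (2 ℕ.* k)) * w k

evenSum-suc : ∀ n w → evenSum (suc n) w ≡ evenSum n w + oddSum n (λ k → w (suc k))
evenSum-suc n w = begin
  evenSum (suc n) w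
    ≡⟨ sumTo-suc n _ ⟩
  even 0 + sumTo n (λ k → + (suc n C (2 ℕ.* suc k)) * w (suc k))
    ≡⟨ cong (λ u → even 0 + u) (sumTo-cong n pascal-suc) ⟩
  even 0 + sumTo n (λ k → odd k + even (suc k))
    ≡⟨ cong (λ u → even 0 + u) (sumTo-+ n odd (λ k → even (suc k))) ⟩
  even 0 + (oddSum n (λ k → w (suc k)) + sumTo n (λ k → even (suc k)))
    ≡⟨ rearrange (even 0) (oddSum n (λ k → w (suc k))) (sumTo n (λ k → even (suc k))) ⟩
  (even 0 + sumTo n (λ k → even (suc k))) + oddSum n (λ k → w (suc k))
    ≡⟨ cong (_+ oddSum n (λ k → w (suc k))) (trans (sym (sumTo-suc n even)) (evenSum-extend n w)) ⟩
  evenSum n w + oddSum n (λ k → w (suc k))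
    ∎
  where
  even odd : ℕ → ℤ
  even k = + (n C (2 ℕ.* k)) * w k
  odd  k = + (n C suc (2 ℕ.* k)) * w (suc k)

  pascal-suc : ∀ k → + (suc n C (2 ℕ.* suc k)) * w (suc k) ≡ odd k + even (suc k)
  pascal-suc k = subst (λ j → + (suc n C j) * w (suc k) ≡ odd k + + (n C j) * w (suc k))
    (sym (ℕP.*-suc 2 k)) (C-pascal n (suc (2 ℕ.* k)) (w (suc k)))

  rearrange : ∀ a b c → a + (b + c) ≡ (a + c) + b
  rearrange = solve-∀

oddSum-scale : ∀ n a w → oddSum n (λ k → a * w k) ≡ a * oddSum n w
oddSum-scale n a w = trans
  (sumTo-cong n (λ k → swap (+ (n C suc (2 ℕ.* k))) a (w k)))
  (sumTo-*ˡ n a (λ k → + (n C suc (2 ℕ.* k)) * w k))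
  where
  swap : ∀ b a x → b * (a * x) ≡ a * (b * x)
  swap = solve-∀

binomialWeight : ℤ → ℕ → (ℤ → ℤ) → ℤ → ℕ → ℤ
binomialWeight c d G s k = (c * c) ^ k * G (+ (2 ℕ.* d ℕ.* k) + s)

binomialWeight-suc : ∀ c d G s k →
  binomialWeight c d G s (suc k) ≡ c * (c * binomialWeight c d G (+ d + (+ d + s)) k)
binomialWeight-suc c d G s k = begin
  (c * c) * (c * c) ^ k * G (+ (2 ℕ.* d ℕ.* suc k) + s)
    ≡⟨ cong (λ t → (c * c) * (c * c) ^ k * G t) 2d[k+1]+s≡2dk+[d+[d+s]] ⟩
  (c * c) * (c * c) ^ k * G (+ (2 ℕ.* d ℕ.* k) + (+ d + (+ d + s)))
    ≡⟨ rearrange c ((c * c) ^ k) (G (+ (2 ℕ.* d ℕ.* k) + (+ d + (+ d + s)))) ⟩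
  c * (c * ((c * c) ^ k * G (+ (2 ℕ.* d ℕ.* k) + (+ d + (+ d + s)))))
    ∎
  where
  rearrange : ∀ c p g → (c * c) * p * g ≡ c * (c * (p * g))
  rearrange = solve-∀

  2d[k+1]≡2dk+[d+d] : ∀ d k → 2 ℕ.* d ℕ.* suc k ≡ 2 ℕ.* d ℕ.* k ℕ.+ (d ℕ.+ d)
  2d[k+1]≡2dk+[d+d] = ℕSolver.solve-∀

  2d[k+1]+s≡2dk+[d+[d+s]] : + (2 ℕ.* d ℕ.* suc k) + s ≡ + (2 ℕ.* d ℕ.* k) + (+ d + (+ d + s))
  2d[k+1]+s≡2dk+[d+[d+s]] = begin
    + (2 ℕ.* d ℕ.* suc k) + s
      ≡⟨ cong (λ j → + j + s) (2d[k+1]≡2dk+[d+d] d k) ⟩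
    + (2 ℕ.* d ℕ.* k ℕ.+ (d ℕ.+ d)) + s
      ≡⟨ shift-assoc (2 ℕ.* d ℕ.* k) (d ℕ.+ d) s ⟩
    + (2 ℕ.* d ℕ.* k) + (+ (d ℕ.+ d) + s)
      ≡⟨ cong (λ t → + (2 ℕ.* d ℕ.* k) + t) (shift-assoc d d s) ⟩
    + (2 ℕ.* d ℕ.* k) + (+ d + (+ d + s))
      ∎

shiftPower-binomial : ∀ c d G n s →
  evenSum n (binomialWeight c d G s) + c * oddSum n (binomialWeight c d G (+ d + s))
  ≡ shiftPower c d n G s
shiftPower-binomial c d G zero s = trans
  (drop-zero c (binomialWeight c d G s 0) (binomialWeight c d G (+ d + s) 0))
  (sym (scaledShift-zero (c * c) (2 ℕ.* d) G s))
  where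
  drop-zero : ∀ c x y → + 1 * x + c * (+ 0 * y) ≡ x
  drop-zero = solve-∀
shiftPower-binomial c d G (suc n) s = begin
  evenSum (suc n) (w s) + c * oddSum (suc n) (w s')
    ≡⟨ cong₂ (λ x y → x + c * y) (evenSum-suc n (w s)) (oddSum-suc n (w s')) ⟩
  (evenSum n (w s) + oddSum n (λ k → w s (suc k))) + c * (evenSum n (w s') + oddSum n (w s'))
    ≡⟨ cong (λ x → (evenSum n (w s) + x) + c * (evenSum n (w s') + oddSum n (w s'))) odd-shift ⟩
  (evenSum n (w s) + c * (c * oddSum n (w s''))) + c * (evenSum n (w s') + oddSum n (w s'))
    ≡⟨ regroup c (evenSum n (w s)) (oddSum n (w s')) (evenSum n (w s')) (oddSum n (w s'')) ⟩
  (evenSum n (w s) + c * oddSum n (w s')) + c * (evenSum n (w s') + c * oddSum n (w s''))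
    ≡⟨ cong₂ (λ x y → x + c * y) (shiftPower-binomial c d G n s) (shiftPower-binomial c d G n s') ⟩
  shiftPower c d n G s + c * shiftPower c d n G s'
    ∎
  where
  w : ℤ → ℕ → ℤ
  w = binomialWeight c d G

  s' s'' : ℤ
  s'  = + d + s
  s'' = + d + s'

  odd-shift : oddSum n (λ k → w s (suc k)) ≡ c * (c * oddSum n (w s''))
  odd-shift = begin
    oddSum n (λ k → w s (suc k))
      ≡⟨ sumTo-cong n (λ k → cong (+ (n C suc (2 ℕ.* k)) *_) (binomialWeight-suc c d G s k)) ⟩
    oddSum n (λ k → c * (c * w s'' k))
      ≡⟨ oddSum-scale n c (λ k → c * w s'' k) ⟩
    c * oddSum n (λ k → c * w s'' k)
      ≡⟨ cong (c *_) (oddSum-scale n c (w s'')) ⟩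
    c * (c * oddSum n (w s''))
      ∎

  regroup : ∀ c e o e' o'' → (e + c * (c * o'')) + c * (e' + o) ≡ (e + c * o) + c * (e' + c * o'')
  regroup = solve-∀

half-bound : ∀ n k → n / 2 ℕ.< k → n ℕ.< 2 ℕ.* k
half-bound n k n/2<k = ℕP.≰⇒> λ 2k≤n → ℕP.<⇒≱ n/2<k
  (subst (ℕ._≤ n / 2) (m*n/n≡m k 2) (/-monoˡ-≤ 2 (subst (ℕ._≤ n) (ℕP.*-comm 2 k) 2k≤n)))

evenSum-half : ∀ n w → sumTo (n / 2) (λ k → + (n C (2 ℕ.* k)) * w k) ≡ evenSum n w
evenSum-half n w = sym (sumTo-vanishing-tail _ (m/n≤m n 2)
  (λ k n/2<k → C-vanishing (half-bound n k n/2<k) (w k)))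

twice-evenSum : ∀ G n s →
  + 2 * sumTo (n / 2) (λ k → + (n C (2 ℕ.* k)) * ((+ 9) ^ k) * G (+ (6 ℕ.* k) + s))
  ≡ shiftPower (+ 3) 3 n G s + shiftPower (- + 3) 3 n G s
twice-evenSum G n s = begin
  + 2 * sumTo (n / 2) (λ k → + (n C (2 ℕ.* k)) * ((+ 9) ^ k) * G (+ (6 ℕ.* k) + s))
    ≡⟨ cong (+ 2 *_) (trans (sumTo-cong (n / 2) (λ k → *-assoc (+ (n C (2 ℕ.* k))) _ _))
                            (evenSum-half n _)) ⟩
  + 2 * evenSum n (w⁺ s)
    ≡⟨ split (evenSum n (w⁺ s)) (oddSum n (w⁺ (+ 3 + s))) ⟩
  (evenSum n (w⁺ s) + + 3 * oddSum n (w⁺ (+ 3 + s)))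
    + (evenSum n (w⁻ s) + - + 3 * oddSum n (w⁻ (+ 3 + s)))
    ≡⟨ cong₂ _+_ (shiftPower-binomial (+ 3) 3 G n s) (shiftPower-binomial (- + 3) 3 G n s) ⟩
  shiftPower (+ 3) 3 n G s + shiftPower (- + 3) 3 n G s
    ∎
  where
  -- w⁺ and w⁻ are definitionally equal: both (+ 3) * (+ 3) and (- + 3) * (- + 3) compute to + 9.
  w⁺ w⁻ : ℤ → ℕ → ℤ
  w⁺ = binomialWeight (+ 3) 3 G
  w⁻ = binomialWeight (- + 3) 3 G

  split : ∀ e o → + 2 * e ≡ (e + + 3 * o) + (e + - + 3 * o)
  split = solve-∀

^-distribʳ-* : ∀ x y n → (x * y) ^ n ≡ x ^ n * y ^ n
^-distribʳ-* x y zero    = refl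
^-distribʳ-* x y (suc n) =
  trans (cong ((x * y) *_) (^-distribʳ-* x y n)) (interchange-* x y (x ^ n) (y ^ n))
  where
  interchange-* : ∀ x y a b → (x * y) * (a * b) ≡ (x * a) * (y * b)
  interchange-* = solve-∀

20^m≡4^m*5^m : ∀ m → (+ 20) ^ m ≡ (+ 2) ^ (2 ℕ.* m) * (+ 5) ^ m
20^m≡4^m*5^m m = trans (^-distribʳ-* (+ 4) (+ 5) m) (cong (_* (+ 5) ^ m) (^-*-assoc (+ 2) 2 m))

twice-evenSum-even : ∀ (G : ℤ → ℤ) →
  (∀ t → shiftStep (+ 3) 3 G t ≡ + 2 * G (+ 4 + t)) →
  (∀ t → shiftStep (- + 3) 3 (shiftStep (- + 3) 3 G) t ≡ + 20 * G (+ 4 + t)) →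
  ∀ n m s → n ≡ 2 ℕ.* m →
  + 2 * sumTo (n / 2) (λ k → + (n C (2 ℕ.* k)) * ((+ 9) ^ k) * G (+ (6 ℕ.* k) + s))
  ≡ (+ 2) ^ n * (G (+ (4 ℕ.* n) + s) + (+ 5) ^ m * G (+ (2 ℕ.* n) + s))
twice-evenSum-even G [1+3E³]≡2E⁴ [1-3E³]²≡20E⁴ n m s refl = begin
  + 2 * sumTo (n / 2) (λ k → + (n C (2 ℕ.* k)) * ((+ 9) ^ k) * G (+ (6 ℕ.* k) + s))
    ≡⟨ twice-evenSum G n s ⟩
  shiftPower (+ 3) 3 n G s + shiftPower (- + 3) 3 n G s
    ≡⟨ cong₂ _+_ (shiftPower-eigen (+ 3) 3 (+ 2) 4 [1+3E³]≡2E⁴ n s)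
                 (shiftPower-even (- + 3) 3 (+ 20) 4 [1-3E³]²≡20E⁴ m s) ⟩
  (+ 2) ^ n * G (+ (4 ℕ.* n) + s) + (+ 20) ^ m * G (+ (4 ℕ.* m) + s)
    ≡⟨ cong₂ (λ p j → (+ 2) ^ n * G (+ (4 ℕ.* n) + s) + p * G (+ j + s))
             (20^m≡4^m*5^m m) (ℕP.*-assoc 2 2 m) ⟩
  (+ 2) ^ n * G (+ (4 ℕ.* n) + s) + (+ 2) ^ n * (+ 5) ^ m * G (+ (2 ℕ.* n) + s)
    ≡⟨ factor ((+ 2) ^ n) (G (+ (4 ℕ.* n) + s)) ((+ 5) ^ m) (G (+ (2 ℕ.* n) + s)) ⟩
  (+ 2) ^ n * (G (+ (4 ℕ.* n) + s) + (+ 5) ^ m * G (+ (2 ℕ.* n) + s))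
    ∎
  where
  factor : ∀ x g p h → x * g + x * p * h ≡ x * (g + p * h)
  factor = solve-∀

-- The cofactor 5ʲ lets one lemma cover F (j = 0, K = L) and L (j = 1, K = F).
twice-evenSum-odd : ∀ (G K : ℤ → ℤ) (j : ℕ) →
  (∀ t → shiftStep (+ 3) 3 G t ≡ + 2 * G (+ 4 + t)) →
  (∀ t → shiftStep (- + 3) 3 (shiftStep (- + 3) 3 G) t ≡ + 20 * G (+ 4 + t)) →
  (∀ t → shiftStep (- + 3) 3 G t ≡ - (+ 2 * (+ 5) ^ j) * K (+ 2 + t)) →
  ∀ n m s → n ≡ 2 ℕ.* m ℕ.+ 1 →
  + 2 * sumTo (n / 2) (λ k → + (n C (2 ℕ.* k)) * ((+ 9) ^ k) * G (+ (6 ℕ.* k) + s))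
  ≡ (+ 2) ^ n * (G (+ (4 ℕ.* n) + s) - (+ 5) ^ (j ℕ.+ m) * K (+ (2 ℕ.* n) + s))
twice-evenSum-odd G K j [1+3E³]≡2E⁴ [1-3E³]²≡20E⁴ [1-3E³]≡cE²K n m s n≡2m+1
  rewrite trans n≡2m+1 (ℕP.+-comm (2 ℕ.* m) 1) = begin
  + 2 * sumTo (n' / 2) (λ k → + (n' C (2 ℕ.* k)) * ((+ 9) ^ k) * G (+ (6 ℕ.* k) + s))
    ≡⟨ twice-evenSum G n' s ⟩
  shiftPower (+ 3) 3 n' G s + shiftPower (- + 3) 3 n' G s
    ≡⟨ cong₂ _+_ (shiftPower-eigen (+ 3) 3 (+ 2) 4 [1+3E³]≡2E⁴ n' s)
                 (shiftPower-odd (- + 3) 3 (+ 20) 4 [1-3E³]²≡20E⁴ m s) ⟩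
  x * g + (+ 20) ^ m * shiftStep (- + 3) 3 G (+ (4 ℕ.* m) + s)
    ≡⟨ cong₂ (λ p y → x * g + p * y) (20^m≡4^m*5^m m)
             (trans ([1-3E³]≡cE²K (+ (4 ℕ.* m) + s))
                    (cong (λ t → - (+ 2 * (+ 5) ^ j) * K t) 2+4m+s≡2n'+s)) ⟩
  x * g + (+ 2) ^ (2 ℕ.* m) * (+ 5) ^ m * (- (+ 2 * (+ 5) ^ j) * k)
    ≡⟨ factor ((+ 2) ^ (2 ℕ.* m)) g ((+ 5) ^ m) ((+ 5) ^ j) k ⟩
  x * (g - (+ 5) ^ j * (+ 5) ^ m * k)
    ≡⟨ cong (λ q → x * (g - q * k)) (sym (^-distribˡ-+-* (+ 5) j m)) ⟩
  x * (g - (+ 5) ^ (j ℕ.+ m) * k)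
    ∎
  where
  n' : ℕ
  n' = suc (2 ℕ.* m)

  x g k : ℤ
  x = (+ 2) ^ n'
  g = G (+ (4 ℕ.* n') + s)
  k = K (+ (2 ℕ.* n') + s)

  2+4m≡2[2m+1] : ∀ m → 2 ℕ.+ 4 ℕ.* m ≡ 2 ℕ.* suc (2 ℕ.* m)
  2+4m≡2[2m+1] = ℕSolver.solve-∀

  2+4m+s≡2n'+s : + 2 + (+ (4 ℕ.* m) + s) ≡ + (2 ℕ.* n') + s
  2+4m+s≡2n'+s = trans (sym (shift-assoc 2 (4 ℕ.* m) s)) (cong (λ i → + i + s) (2+4m≡2[2m+1] m))

  factor : ∀ y g p q k → (+ 2 * y) * g + y * p * (- (+ 2 * q) * k) ≡ (+ 2 * y) * (g - q * p * k)
  factor = solve-∀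

theorem14 : (n : ℕ) → (s : ℤ) →
    ((m : ℕ) → n ≡ 2 ℕ.* m →
      ((+ 2) * sumTo (n / 2) (λ k → + (n C (2 ℕ.* k)) * ((+ 9) ^ k) * F (+ (6 ℕ.* k) + s))
        ≡ ((+ 2) ^ n) * (F (+ (4 ℕ.* n) + s) + ((+ 5) ^ m) * F (+ (2 ℕ.* n) + s)))
      × ((+ 2) * sumTo (n / 2) (λ k → + (n C (2 ℕ.* k)) * ((+ 9) ^ k) * L (+ (6 ℕ.* k) + s))
        ≡ ((+ 2) ^ n) * (L (+ (4 ℕ.* n) + s) + ((+ 5) ^ m) * L (+ (2 ℕ.* n) + s))))
    × ((m : ℕ) → n ≡ 2 ℕ.* m ℕ.+ 1 →
      ((+ 2) * sumTo (n / 2) (λ k → + (n C (2 ℕ.* k)) * ((+ 9) ^ k) * F (+ (6 ℕ.* k) + s))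
        ≡ ((+ 2) ^ n) * (F (+ (4 ℕ.* n) + s) - ((+ 5) ^ m) * L (+ (2 ℕ.* n) + s)))
      × ((+ 2) * sumTo (n / 2) (λ k → + (n C (2 ℕ.* k)) * ((+ 9) ^ k) * L (+ (6 ℕ.* k) + s))
        ≡ ((+ 2) ^ n) * (L (+ (4 ℕ.* n) + s) - ((+ 5) ^ (ℕ.suc m)) * F (+ (2 ℕ.* n) + s))))
theorem14 n s =
  (λ m n≡2m →
      twice-evenSum-even F F-[1+3E³]≡2E⁴ F-[1-3E³]²≡20E⁴ n m s n≡2m
    , twice-evenSum-even L L-[1+3E³]≡2E⁴ L-[1-3E³]²≡20E⁴ n m s n≡2m)
  , (λ m n≡2m+1 →
      twice-evenSum-odd F L 0 F-[1+3E³]≡2E⁴ F-[1-3E³]²≡20E⁴ F-[1-3E³]≡-2E²L n m s n≡2m+1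
    , twice-evenSum-odd L F 1 L-[1+3E³]≡2E⁴ L-[1-3E³]²≡20E⁴ L-[1-3E³]≡-10E²F n m s n≡2m+1)
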